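{- Let $\mathcal{T}$ be the space of torsion-free abelian group operations on $\mathbb{N}$ with identity $0$ (as defined in the context), and let $\mathcal{P}\subseteq\mathcal{S}\subseteq\mathcal{T}$ be group properties. If for every $G\in\mathcal{S}$ there exists $H\in\mathcal{P}$ such that the group $(\mathbb{N},G)$ embeds (as a group) into $(\mathbb{N},H)$, then $\mathcal{P}$ is dense in $\mathcal{S}$.
   Context: $\mathbb{N}=\{0,1,2,\ldots\}$. $\mathcal{T}$ is the set of functions $G:\mathbb{N}\times\mathbb{N}\to\mathbb{N}$ that are the operation of a torsion-free abelian group on $\mathbb{N}$ with identity element $0$, with the subspace topology from the product $\mathbb{N}^{\mathbb{N}\times\mathbb{N}}$ (each factor discrete). A set $\mathcal{P}\subseteq\mathcal{T}$ is a group property if it is invariant under isomorphism: whenever $G\in\mathcal{T}$ and $(\mathbb{N},G)$ is isomorphic to $(\mathbb{N},H)$ for some $H\in\mathcal{P}$, then $G\in\mathcal{P}$. Density of $\mathcal{P}$ in $\mathcal{S}$ is with respect to the subspace topology on $\mathcal{S}$. -}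

module Defs where

open import Data.Nat using (ℕ; zero; suc; _<_)
open import Data.Product using (Σ; ∃; _×_; _,_)
open import Data.List using (List)
open import Data.List.Membership.Propositional using (_∈_)
open import Relation.Binary.PropositionalEquality using (_≡_)
open import Function.Definitions using (Injective; Bijective)

-- A binary operation on ℕ (a point of ℕ^(ℕ×ℕ)).
Op : Set
Op = ℕ → ℕ → ℕ

mul : Op → ℕ → ℕ → ℕ
mul G zero    x = 0
mul G (suc n) x = G x (mul G n x)

record IsTFAG (G : Op) : Set where
  field
    assoc      : ∀ x y z → G (G x y) z ≡ G x (G y z)
    comm       : ∀ x y → G x y ≡ G y x
    identityˡ  : ∀ x → G 0 x ≡ x
    inverse    : ∀ x → ∃ λ y → G x y ≡ 0
    torsionFree : ∀ n x → 0 < n → mul G n x ≡ 0 → x ≡ 0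

Subset𝒯 : Set₁
Subset𝒯 = Op → Set

_⊆_ : Subset𝒯 → Subset𝒯 → Set
P ⊆ S = ∀ G → P G → S G

IsHom : Op → Op → (ℕ → ℕ) → Set
IsHom G H f = ∀ x y → f (G x y) ≡ H (f x) (f y)

Isomorphic : Op → Op → Set
Isomorphic G H = Σ (ℕ → ℕ) λ f → Bijective _≡_ _≡_ f × IsHom G H f

Embeds : Op → Op → Set
Embeds G H = Σ (ℕ → ℕ) λ f → Injective _≡_ _≡_ f × IsHom G H f

record GroupProperty (P : Subset𝒯) : Set where
  field
    sub𝒯   : ∀ G → P G → IsTFAG G
    invariant : ∀ G H → IsTFAG G → P H → Isomorphic G H → P G

AgreeOn : List (ℕ × ℕ) → Op → Op → Set
AgreeOn F G H = ∀ {i j} → (i , j) ∈ F → G i j ≡ H i j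

-- P is dense in S (subspace topology from the product of discrete ℕ's):
-- every basic open set {H | H agrees with G on a finite set F of coordinates}
-- around a point G of S meets P.
DenseIn : Subset𝒯 → Subset𝒯 → Set
DenseIn P S = ∀ G → S G → (F : List (ℕ × ℕ)) → ∃ λ H → P H × AgreeOn F H G

-- An embedding f : (ℕ,G) → (ℕ,H) fixes 0, and on the finitely many points mentioned by a
-- basic neighbourhood of G it is a finite partial injection of ℕ, so it extends to a
-- permutation π of ℕ with π 0 = 0.  Transporting H along π gives a torsion-free abelian group
-- operation isomorphic to H, hence in P, and it agrees with G on the neighbourhood because
-- f is a homomorphism there.
module Submission where

open import Defs
open import Data.Product using (∃; _×_; _,_)
open import Data.Nat using (ℕ; zero; suc) renaming (_≟_ to _≟ℕ_)
open import Data.List using (List; []; _∷_)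
open import Data.List.Relation.Unary.Any using (here; there)
open import Data.List.Membership.Propositional using (_∈_)
open import Data.Empty using (⊥-elim)
open import Function using (_∘_)
open import Function.Bundles using (_↔_; Inverse; mk↔ₛ′; Bijection)
open import Function.Definitions using (Injective)
open import Function.Properties.Inverse using (↔-refl; ↔-trans; ↔⇒⤖)
open import Relation.Binary.Definitions using (DecidableEquality)
open import Relation.Binary.PropositionalEquality
open import Relation.Nullary using (Dec; yes; no; ¬_)

open Inverse using (to; from; strictlyInverseˡ; strictlyInverseʳ)

module _ {A : Set} (_≟_ : DecidableEquality A) where

  swap : A → A → A → A
  swap a b x with x ≟ a
  ... | yes _ = b
  ... | no _ with x ≟ b
  ...   | yes _ = a
  ...   | no _ = x

  swap-left : ∀ a b → swap a b a ≡ b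
  swap-left a b with a ≟ a
  ... | yes _ = refl
  ... | no a≢a = ⊥-elim (a≢a refl)

  swap-right : ∀ a b → swap a b b ≡ a
  swap-right a b with b ≟ a
  ... | yes refl = refl
  ... | no _ with b ≟ b
  ...   | yes _ = refl
  ...   | no b≢b = ⊥-elim (b≢b refl)

  swap-other : ∀ a b {x} → ¬ x ≡ a → ¬ x ≡ b → swap a b x ≡ x
  swap-other a b {x} x≢a x≢b with x ≟ a
  ... | yes x≡a = ⊥-elim (x≢a x≡a)
  ... | no _ with x ≟ b
  ...   | yes x≡b = ⊥-elim (x≢b x≡b)
  ...   | no _ = refl

  swap-involutive : ∀ a b x → swap a b (swap a b x) ≡ x
  swap-involutive a b x = by-cases (x ≟ a) (x ≟ b)
    where
    by-cases : Dec (x ≡ a) → Dec (x ≡ b) → swap a b (swap a b x) ≡ x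
    by-cases (yes refl) _ = trans (cong (swap x b) (swap-left x b)) (swap-right x b)
    by-cases (no _) (yes refl) = trans (cong (swap a x) (swap-right a x)) (swap-left a x)
    by-cases (no x≢a) (no x≢b) =
      trans (cong (swap a b) (swap-other a b x≢a x≢b)) (swap-other a b x≢a x≢b)

  transposition : A → A → A ↔ A
  transposition a b = mk↔ₛ′ (swap a b) (swap a b) (swap-involutive a b) (swap-involutive a b)

  -- Compose with the transposition moving π a to f a; it fixes π x = f x for the earlier
  -- points x ≠ a because both π and f are injective.
  injection-extends-to-permutation :
    (f : A → A) → Injective _≡_ _≡_ f → (L : List A) →
    ∃ λ (π : A ↔ A) → ∀ {x} → x ∈ L → to π x ≡ f x
  injection-extends-to-permutation f f-inj [] = ↔-refl , λ ()
  injection-extends-to-permutation f f-inj (a ∷ L)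
    with injection-extends-to-permutation f f-inj L
  ... | π , π≗f = ↔-trans π (transposition (to π a) (f a)) , π′≗f
    where
    π-inj : Injective _≡_ _≡_ (to π)
    π-inj = Bijection.injective (↔⇒⤖ π)

    π′≗f : ∀ {x} → x ∈ a ∷ L → swap (to π a) (f a) (to π x) ≡ f x
    π′≗f (here refl) = swap-left (to π a) (f a)
    π′≗f {x} (there x∈L) with x ≟ a
    ... | yes refl = swap-left (to π a) (f a)
    ... | no x≢a =
      trans (swap-other (to π a) (f a) (x≢a ∘ π-inj) (x≢a ∘ f-inj ∘ trans (sym (π≗f x∈L))))
            (π≗f x∈L)

module _ {H : Op} (T : IsTFAG H) where
  open IsTFAG T

  idempotent⇒identity : ∀ z → H z z ≡ z → z ≡ 0
  idempotent⇒identity z zz≡z with inverse z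
  ... | w , zw≡0 = begin
    z           ≡⟨ sym (identityˡ z) ⟩
    H 0 z       ≡⟨ comm 0 z ⟩
    H z 0       ≡⟨ cong (H z) (sym zw≡0) ⟩
    H z (H z w) ≡⟨ sym (assoc z z w) ⟩
    H (H z z) w ≡⟨ cong (λ u → H u w) zz≡z ⟩
    H z w       ≡⟨ zw≡0 ⟩
    0           ∎
    where open ≡-Reasoning

  hom-preserves-identity : ∀ {G f} → G 0 0 ≡ 0 → IsHom G H f → f 0 ≡ 0
  hom-preserves-identity {f = f} G00≡0 f-hom =
    idempotent⇒identity (f 0) (trans (sym (f-hom 0 0)) (cong f G00≡0))

transport : ℕ ↔ ℕ → Op → Op
transport π H x y = from π (H (to π x) (to π y))

module _ (π : ℕ ↔ ℕ) (π0≡0 : to π 0 ≡ 0) {H : Op} (T : IsTFAG H) where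
  private
    σ = to π
    ρ = from π
    ρσ = strictlyInverseʳ π
    σρ = strictlyInverseˡ π

    ρ0≡0 : ρ 0 ≡ 0
    ρ0≡0 = trans (cong ρ (sym π0≡0)) (ρσ 0)

  mul-transport : ∀ n x → mul (transport π H) n x ≡ ρ (mul H n (σ x))
  mul-transport zero x = sym ρ0≡0
  mul-transport (suc n) x =
    cong (λ u → ρ (H (σ x) u)) (trans (cong σ (mul-transport n x)) (σρ _))

  transport-isTFAG : IsTFAG (transport π H)
  transport-isTFAG = record
    { assoc = λ x y z → cong ρ (begin
        H (σ (ρ (H (σ x) (σ y)))) (σ z) ≡⟨ cong (λ u → H u (σ z)) (σρ _) ⟩
        H (H (σ x) (σ y)) (σ z)         ≡⟨ assoc _ _ _ ⟩
        H (σ x) (H (σ y) (σ z))         ≡⟨ cong (H (σ x)) (sym (σρ _)) ⟩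
        H (σ x) (σ (ρ (H (σ y) (σ z)))) ∎)
    ; comm = λ x y → cong ρ (comm _ _)
    ; identityˡ = λ x → begin
        ρ (H (σ 0) (σ x)) ≡⟨ cong (λ u → ρ (H u (σ x))) π0≡0 ⟩
        ρ (H 0 (σ x))     ≡⟨ cong ρ (identityˡ _) ⟩
        ρ (σ x)           ≡⟨ ρσ x ⟩
        x                 ∎
    ; inverse = λ x → let (w , σx+w≡0) = inverse (σ x) in
        ρ w , (begin
          ρ (H (σ x) (σ (ρ w))) ≡⟨ cong (λ u → ρ (H (σ x) u)) (σρ w) ⟩
          ρ (H (σ x) w)         ≡⟨ cong ρ σx+w≡0 ⟩
          ρ 0                   ≡⟨ ρ0≡0 ⟩
          0                     ∎)
    ; torsionFree = λ n x 0<n nx≡0 →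
        let nσx≡0 : mul H n (σ x) ≡ 0
            nσx≡0 = trans (sym (σρ _))
                      (trans (cong σ (trans (sym (mul-transport n x)) nx≡0)) π0≡0)
        in trans (sym (ρσ x)) (trans (cong ρ (torsionFree n (σ x) 0<n nσx≡0)) ρ0≡0)
    }
    where open IsTFAG T
          open ≡-Reasoning

transport-isomorphic : ∀ π H → Isomorphic (transport π H) H
transport-isomorphic π H = to π , Bijection.bijective (↔⇒⤖ π) , λ x y → strictlyInverseˡ π _

transport-agrees-with-hom :
  ∀ {G H f} (π : ℕ ↔ ℕ) → IsHom G H f → ∀ {i j} →
  to π i ≡ f i → to π j ≡ f j → to π (G i j) ≡ f (G i j) →
  transport π H i j ≡ G i j
transport-agrees-with-hom {G} {H} {f} π f-hom {i} {j} πi πj πij = begin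
  from π (H (to π i) (to π j)) ≡⟨ cong₂ (λ u v → from π (H u v)) πi πj ⟩
  from π (H (f i) (f j))       ≡⟨ cong (from π) (sym (f-hom i j)) ⟩
  from π (f (G i j))           ≡⟨ cong (from π) (sym πij) ⟩
  from π (to π (G i j))        ≡⟨ strictlyInverseʳ π _ ⟩
  G i j                        ∎
  where open ≡-Reasoning

support : Op → List (ℕ × ℕ) → List ℕ
support G [] = []
support G ((i , j) ∷ F) = i ∷ j ∷ G i j ∷ support G F

∈-support : ∀ G F {i j} → (i , j) ∈ F →
            i ∈ support G F × j ∈ support G F × G i j ∈ support G F
∈-support G (_ ∷ F) (here refl) = here refl , there (here refl) , there (there (here refl))
∈-support G (_ ∷ F) (there ij∈F) with ∈-support G F ij∈F
... | i∈ , j∈ , ij∈ = there (there (there i∈)) , there (there (there j∈)) , there (there (there ij∈))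

lemma2p12 : (P S : Subset𝒯) → GroupProperty P → GroupProperty S → P ⊆ S →
            (∀ G → S G → ∃ λ H → P H × Embeds G H) →
            DenseIn P S
lemma2p12 P S gP gS _ embeds G SG F with embeds G SG
... | H , PH , f , f-inj , f-hom
    with injection-extends-to-permutation _≟ℕ_ f f-inj (0 ∷ support G F)
... | π , π≗f = transport π H , P-transport , agree
  where
  TG = GroupProperty.sub𝒯 gS G SG
  TH = GroupProperty.sub𝒯 gP H PH

  π0≡0 : to π 0 ≡ 0
  π0≡0 = trans (π≗f (here refl))
               (hom-preserves-identity TH (IsTFAG.identityˡ TG 0) f-hom)

  P-transport : P (transport π H)
  P-transport = GroupProperty.invariant gP _ H (transport-isTFAG π π0≡0 TH) PH
                  (transport-isomorphic π H)

  agree : AgreeOn F (transport π H) G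
  agree ij∈F with ∈-support G F ij∈F
  ... | i∈ , j∈ , ij∈ =
    transport-agrees-with-hom {H = H} π f-hom (π≗f (there i∈)) (π≗f (there j∈)) (π≗f (there ij∈))
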